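{- Let $n\ge 1$, let $D\subseteq\mathbb{Z}_4^n$ be a transversal of the subgroup $2\mathbb{Z}_4^n$ in $\mathbb{Z}_4^n$, let $h:\mathbb{F}_2^n\to\mathbb{F}_2^n$ be its $\mathbb{F}_2^n$-representation, let $B$ be a basis of $\mathbb{F}_{2^n}$ over $\mathbb{F}_2$ and let $f_B\in\mathbb{F}_{2^n}[x]$ be the $\mathbb{F}_{2^n}$-representation of $D$ with respect to $B$. Then the following are equivalent: (1) $D$ is a $(2^n,2^n,2^n,1)$-relative difference set in $\mathbb{Z}_4^n$ relative to $2\mathbb{Z}_4^n$; (2) for each nonzero $a\in\mathbb{F}_2^n$ the map $\Delta_{h,a}:d\mapsto h(d+a)+h(d)+d\odot a$ is a bijection of $\mathbb{F}_2^n$; (3) for each nonzero $a\in\mathbb{F}_{2^n}$ the polynomial $\nabla_{f_B,a}(x):=f_B(x+a)+f_B(x)+f_B(a)+xa$ is a permutation polynomial of $\mathbb{F}_{2^n}$.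
   Context: A $k$-subset $D$ of a group $G$ of order $mn$ with subgroup $N$ of order $n$ is an $(m,n,k,\lambda)$-relative difference set relative to $N$ if every element of $G\setminus N$ is represented exactly $\lambda$ times as a difference $d-d'$ with $d,d'\in D$, and no nonzero element of $N$ is so represented. Let $\psi:\mathbb{F}_2\to\mathbb{Z}_4=\{0,1,2,3\}$ be given by $0\mapsto 0$, $1\mapsto 1$, and $\Psi:\mathbb{F}_2^n\to\mathbb{Z}_4^n$ apply $\psi$ coordinatewise. Every element of $\mathbb{Z}_4^n$ is uniquely of the form $\lfloor a,b\rfloor:=\Psi(a)+2\Psi(b)$ with $a,b\in\mathbb{F}_2^n$. For $a,c\in\mathbb{F}_2^n$, $a\odot c=(a_0c_0,\dots,a_{n-1}c_{n-1})$. If $D$ is a transversal of $2\mathbb{Z}_4^n=\{\lfloor 0,b\rfloor\}$, each element of $D$ is uniquely $\lfloor d,h(d)\rfloor$ for a map $h:\mathbb{F}_2^n\to\mathbb{F}_2^n$, called the $\mathbb{F}_2^n$-representation of $D$. For a basis $B=\{\xi_0,\dots,\xi_{n-1}\}$ of $\mathbb{F}_{2^n}$ over $\mathbb{F}_2$, identify $x=\sum x_i\xi_i\in\mathbb{F}_{2^n}$ with $(x_0,\dots,x_{n-1})\in\mathbb{F}_2^n$; let $h_B:\mathbb{F}_{2^n}\to\mathbb{F}_{2^n}$ be $h$ viewed via this identification (written as a polynomial), let $\mu_B(x)=\sum_{i<j}x_ix_j\xi_i\xi_j$, and define $f_B(x)=h_B(x)^2+\mu_B(x)$, the $\mathbb{F}_{2^n}$-representation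 of $D$ with respect to $B$. -}

module Defs where

open import Level using (Level; _⊔_)
open import Data.Bool using (Bool; true; false; _xor_; _∧_; if_then_else_; T)
open import Data.Nat using (ℕ; zero; suc)
import Data.Nat as ℕ
open import Data.Nat.DivMod using (_mod_)
open import Data.Fin using (Fin; toℕ) renaming (zero to fz; suc to fs)
import Data.Fin as Fin
open import Data.Vec using (Vec; []; _∷_; zipWith; replicate; lookup; allFin) renaming (map to vmap)
import Data.Vec as Vec
open import Data.Vec.Properties using (≡-dec)
open import Data.List using (List; []; _∷_; length; filterᵇ; cartesianProduct; concatMap; foldr) renaming (map to lmap)
import Data.List as List
open import Data.Product using (_×_; _,_; proj₁; proj₂; ∃)
open import Relation.Nullary using (¬_; does)
open import Relation.Binary.PropositionalEquality using (_≡_)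
open import Function.Definitions using (Bijective)
open import Algebra.Bundles using (CommutativeRing)

-- F₂ = Bool (addition = xor, multiplication = ∧), F₂ⁿ = Vec Bool n

_⊕_ : ∀ {n} → Vec Bool n → Vec Bool n → Vec Bool n
_⊕_ = zipWith _xor_

_⊙_ : ∀ {n} → Vec Bool n → Vec Bool n → Vec Bool n
_⊙_ = zipWith _∧_

Z4 : Set
Z4 = Fin 4

_+₄_ : Z4 → Z4 → Z4
a +₄ b = (toℕ a ℕ.+ toℕ b) mod 4

-₄_ : Z4 → Z4
-₄ a = (4 ℕ.∸ toℕ a) mod 4

_-₄_ : Z4 → Z4 → Z4
a -₄ b = a +₄ (-₄ b)

_-ᵥ_ : ∀ {n} → Vec Z4 n → Vec Z4 n → Vec Z4 n
_-ᵥ_ = zipWith _-₄_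

0ᵥ : ∀ {n} → Vec Z4 n
0ᵥ = replicate _ fz

ψ : Bool → Z4
ψ false = fz
ψ true  = fs fz

⌊_,_⌋ : ∀ {n} → Vec Bool n → Vec Bool n → Vec Z4 n
⌊ a , b ⌋ = zipWith (λ x y → ψ x +₄ (ψ y +₄ ψ y)) a b

in2Z4 : ∀ {n} → Vec Z4 n → Bool
in2Z4 [] = true
in2Z4 (x ∷ xs) = ev x ∧ in2Z4 xs
  where
  ev : Z4 → Bool
  ev fz = true
  ev (fs (fs fz)) = true
  ev _ = false

allVec : ∀ {A : Set} → List A → (n : ℕ) → List (Vec A n)
allVec xs zero = [] ∷ []
allVec xs (suc n) = concatMap (λ x → lmap (x ∷_) (allVec xs n)) xs

allZ4ⁿ : (n : ℕ) → List (Vec Z4 n)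
allZ4ⁿ = allVec (List.allFin 4)

Subset : ℕ → Set
Subset n = Vec Z4 n → Bool

elems : ∀ {n} → Subset n → List (Vec Z4 n)
elems {n} S = filterᵇ S (allZ4ⁿ n)

card : ∀ {n} → Subset n → ℕ
card S = length (elems S)

reps : ∀ {n} → Subset n → Vec Z4 n → ℕ
reps D g = length (filterᵇ (λ p → does (≡-dec Fin._≟_ (proj₁ p -ᵥ proj₂ p) g))
                           (cartesianProduct (elems D) (elems D)))

IsRDS : (n m n' k λ' : ℕ) → (N : Subset n) → (D : Subset n) → Set
IsRDS n m n' k λ' N D =
  (4 ℕ.^ n ≡ m ℕ.* n') × (card N ≡ n') × (card D ≡ k)
  × (∀ g → N g ≡ false → reps D g ≡ λ')
  × (∀ g → N g ≡ true → ¬ (g ≡ 0ᵥ) → reps D g ≡ 0)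

-- D is a transversal of 2ℤ₄ⁿ: each coset ⌊a,·⌋ meets D in exactly one element
IsTransversal : ∀ {n} → Subset n → Set
IsTransversal {n} D = ∀ (a : Vec Bool n) →
  ∃ λ b → (D ⌊ a , b ⌋ ≡ true) × (∀ b' → D ⌊ a , b' ⌋ ≡ true → b' ≡ b)

IsF2Rep : ∀ {n} → Subset n → (Vec Bool n → Vec Bool n) → Set
IsF2Rep D h = ∀ d → D ⌊ d , h d ⌋ ≡ true

Δ : ∀ {n} → (Vec Bool n → Vec Bool n) → Vec Bool n → Vec Bool n → Vec Bool n
Δ h a d = (h (d ⊕ a) ⊕ h d) ⊕ (d ⊙ a)

module _ {c ℓ : Level} (F : CommutativeRing c ℓ) where
  open CommutativeRing F

  IsField : Set (c ⊔ ℓ)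
  IsField = (¬ (1# ≈ 0#)) × (∀ x → ¬ (x ≈ 0#) → ∃ λ y → (x * y) ≈ 1#)

  Char2 : Set ℓ
  Char2 = (1# + 1#) ≈ 0#

  sumF : List Carrier → Carrier
  sumF = foldr _+_ 0#

  coord : ∀ {n} → Vec Carrier n → Vec Bool n → Carrier
  coord [] [] = 0#
  coord (ξ ∷ ξs) (x ∷ xs) = (if x then ξ else 0#) + coord ξs xs

  record Basis (n : ℕ) : Set (c ⊔ ℓ) where
    field
      ξ   : Vec Carrier n
      bij : Bijective _≡_ _≈_ (coord ξ)

    coords : Carrier → Vec Bool n
    coords y = proj₁ (proj₂ bij y)

    hB : (Vec Bool n → Vec Bool n) → Carrier → Carrier
    hB h x = coord ξ (h (coords x))

    μB : Carrier → Carrier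
    μB x = sumF (lmap term (filterᵇ lt (cartesianProduct (List.allFin n) (List.allFin n))))
      where
      v = coords x
      lt : Fin n × Fin n → Bool
      lt (i , j) = does (toℕ i ℕ.<? toℕ j)
      term : Fin n × Fin n → Carrier
      term (i , j) = if (lookup v i ∧ lookup v j) then (lookup ξ i * lookup ξ j) else 0#

    fB : (Vec Bool n → Vec Bool n) → Carrier → Carrier
    fB h x = (hB h x * hB h x) + μB x

    ∇ : (Vec Bool n → Vec Bool n) → Carrier → Carrier → Carrier
    ∇ h a x = ((fB h (x + a) + fB h x) + fB h a) + (x * a)

  -- a (polynomial) map F → F is a permutation polynomial iff it induces a bijection of F
  IsPermutation : (Carrier → Carrier) → Set (c ⊔ ℓ)
  IsPermutation g = Bijective _≈_ _≈_ g

-- Write the elements of ℤ₄ⁿ as ⌊ a , b ⌋ = a + 2b. Since D is the graph of h, subtracting with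
-- borrows gives ⌊ x , h x ⌋ − ⌊ y , h y ⌋ = ⌊ a , Δ_{h,a}(y) ⌋ where a = x + y. So the pairs of D
-- whose difference is ⌊ a , b ⌋ are in bijection with the solutions of Δ_{h,a}(y) = b, and D is a
-- relative difference set with λ = 1 exactly when every Δ_{h,a} with a ≠ 0 is a bijection.
-- For (2) ⇔ (3), in coordinates the quadratic map μ_B satisfies
-- μ_B(x + a) + μ_B(x) + μ_B(a) = (x ⊙ a)² + x a, and squaring is additive in characteristic 2,
-- so ∇_{f_B,a}(x) = (Δ_{h,a}(x) + h(a))², read through B. Squaring is a bijection of the finite
-- field, hence ∇_{f_B,a} is a permutation exactly when Δ_{h,a} is a bijection.
module Submission where

open import Defs
open import Level using (Level)
open import Data.Nat using (ℕ; _≤_; _^_)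
open import Data.Bool using (Bool)
open import Data.Vec using (Vec; replicate)
open import Data.Product using (_×_; _,_)
open import Relation.Nullary using (¬_)
open import Relation.Binary.PropositionalEquality using (_≡_)
open import Function.Bundles using (_⇔_; mk⇔)
open import Function.Definitions using (Bijective)
open import Algebra.Bundles using (CommutativeRing)

open import Data.Nat using (zero; suc; z≤n; s≤s)
import Data.Nat as ℕ
open import Data.Nat.Properties using (≤-antisym; <-irrefl; ^-*-assoc; ^-distribˡ-+-*)
import Data.Nat.Properties as ℕₚ
open import Data.Bool using (true; false; _xor_; _∧_; T; if_then_else_)
open import Data.Bool.Properties
  using (xor-same; xor-assoc; xor-comm; xor-identityˡ; xor-identityʳ; T-≡; ¬-not) renaming (_≟_ to _≟ᵇ_)
open import Data.Empty using (⊥; ⊥-elim)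
open import Data.Fin using (Fin) renaming (zero to fz; suc to fs)
import Data.Fin as Fin
open import Data.Vec using ([]; _∷_; head; tail; lookup) renaming (map to vmap)
open import Data.Vec.Properties using (≡-dec; lookup-zipWith; zipWith-assoc; zipWith-comm; zipWith-identityˡ; zipWith-identityʳ)
open import Data.List using (List; []; _∷_; length; filterᵇ; cartesianProduct; concatMap) renaming (map to lmap)
import Data.List as List
open import Data.List.Properties using (length-map; length-++; length-removeAt′; map-tabulate; map-++; map-∘)
open import Data.List.Membership.Propositional using (_∈_; _∉_)
open import Data.List.Membership.Propositional.Properties
  using (∈-map⁺; ∈-map⁻; ∈-concatMap⁺; ∈-concatMap⁻; ∈-filter⁺; ∈-filter⁻;
         ∈-cartesianProduct⁺; ∈-cartesianProduct⁻; ∈-allFin)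
import Data.List.Membership.DecPropositional as DecMembership
open import Data.List.Relation.Unary.Any as Any using (here; there; _─_)
open import Data.List.Relation.Unary.All as All using ([]; _∷_)
open import Data.List.Relation.Unary.All.Properties using (¬Any⇒All¬)
open import Data.List.Relation.Unary.AllPairs using ([]; _∷_)
open import Data.List.Relation.Unary.Unique.Propositional using (Unique)
import Data.List.Relation.Unary.Unique.Propositional.Properties as Unique
open import Data.Product using (proj₁; proj₂; ∃; ∃₂)
open import Relation.Nullary using (yes; no; does; Dec; contradiction)
open import Relation.Nullary.Decidable using (T?; dec-true)
open import Relation.Binary.Definitions using (DecidableEquality)
open import Relation.Binary.Bundles using (Setoid)
open import Function.Bundles using (Equivalence; Bijection)
import Relation.Binary.PropositionalEquality as ≡
open import Relation.Binary.PropositionalEquality using (_≢_; refl; cong; cong₂; sym; trans; subst; module ≡-Reasoning)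

-- Finite enumerations

∈-─⁺ : ∀ {A : Set} {x y : A} {ys : List A} → y ∈ ys → y ≢ x → (x∈ys : x ∈ ys) → y ∈ (ys ─ x∈ys)
∈-─⁺ (here refl) y≢x (here refl) = ⊥-elim (y≢x refl)
∈-─⁺ (there y∈ys) y≢x (here _) = y∈ys
∈-─⁺ (here y≡z) y≢x (there _) = here y≡z
∈-─⁺ (there y∈ys) y≢x (there x∈ys) = there (∈-─⁺ y∈ys y≢x x∈ys)

unique⇒length-≤ : ∀ {A : Set} {xs ys : List A} → Unique xs → (∀ {z} → z ∈ xs → z ∈ ys) → length xs ≤ length ys
unique⇒length-≤ {xs = []} _ _ = z≤n
unique⇒length-≤ {xs = x ∷ xs} {ys} (x∉xs ∷ unique) xs⊆ys =
  subst (suc (length xs) ≤_) (sym (length-removeAt′ ys _))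
    (s≤s (unique⇒length-≤ unique (λ z∈xs → ∈-─⁺ (xs⊆ys (there z∈xs)) (z≢x z∈xs) x∈ys)))
  where
  x∈ys = xs⊆ys (here refl)
  z≢x : ∀ {z} → z ∈ xs → z ≢ x
  z≢x z∈xs z≡x = All.lookup x∉xs z∈xs (sym z≡x)

empty⇒length≡0 : ∀ {A : Set} (xs : List A) → (∀ {x} → x ∉ xs) → length xs ≡ 0
empty⇒length≡0 [] _ = refl
empty⇒length≡0 (x ∷ xs) ∉xs = ⊥-elim (∉xs (here refl))

singleton⇒length≡1 : ∀ {A : Set} {xs : List A} {x} → Unique xs → x ∈ xs → (∀ {y} → y ∈ xs → y ≡ x) → length xs ≡ 1
singleton⇒length≡1 unique x∈xs only-x =
  ≤-antisym (unique⇒length-≤ {ys = _ ∷ []} unique (λ y∈xs → here (only-x y∈xs)))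
            (unique⇒length-≤ {xs = _ ∷ []} ([] ∷ []) (λ { (here refl) → x∈xs }))

length≡1⇒∃∈ : ∀ {A : Set} (xs : List A) → length xs ≡ 1 → ∃ λ x → x ∈ xs
length≡1⇒∃∈ (x ∷ _) _ = x , here refl

length≡1⇒∈-unique : ∀ {A : Set} (xs : List A) → length xs ≡ 1 → ∀ {x y} → x ∈ xs → y ∈ xs → x ≡ y
length≡1⇒∈-unique (z ∷ []) _ (here x≡z) (here y≡z) = trans x≡z (sym y≡z)

module _ {A : Set} {n : ℕ} (vs : List (Vec A n)) where

  private
    prepend : A → List (Vec A (suc n))
    prepend x = lmap (x ∷_) vs

  ∈-concatMap-prepend⇒head : ∀ {xs v} → v ∈ concatMap prepend xs → head v ∈ xs
  ∈-concatMap-prepend⇒head {xs} v∈ =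
    Any.map (λ v∈xvs → let (_ , _ , v≡xw) = ∈-map⁻ _ v∈xvs in cong head v≡xw) (∈-concatMap⁻ prepend {xs = xs} v∈)

  concatMap-prepend-unique : Unique vs → ∀ {xs} → Unique xs → Unique (concatMap prepend xs)
  concatMap-prepend-unique _ [] = []
  concatMap-prepend-unique unique-vs {x ∷ xs} (x∉xs ∷ unique-xs) =
    Unique.++⁺ (Unique.map⁺ (cong tail) unique-vs) (concatMap-prepend-unique unique-vs unique-xs) disjoint
    where
    disjoint : ∀ {v} → v ∈ prepend x × v ∈ concatMap prepend xs → ⊥
    disjoint (v∈x , v∈xs) with ∈-map⁻ _ v∈x
    ... | _ , _ , refl = All.lookup x∉xs (∈-concatMap-prepend⇒head v∈xs) refl

  length-concatMap-prepend : ∀ xs → length (concatMap prepend xs) ≡ length xs ℕ.* length vs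
  length-concatMap-prepend [] = refl
  length-concatMap-prepend (x ∷ xs) =
    trans (length-++ (prepend x)) (cong₂ ℕ._+_ (length-map _ vs) (length-concatMap-prepend xs))

∈-allVec : ∀ {A : Set} {xs : List A} → (∀ x → x ∈ xs) → ∀ {n} (v : Vec A n) → v ∈ allVec xs n
∈-allVec complete [] = here refl
∈-allVec {xs = xs} complete {suc n} (x ∷ v) =
  ∈-concatMap⁺ (λ y → lmap (y ∷_) (allVec xs n)) (Any.map (λ { refl → ∈-map⁺ (x ∷_) (∈-allVec complete v) }) (complete x))

allVec-unique : ∀ {A : Set} {xs : List A} → Unique xs → ∀ n → Unique (allVec xs n)
allVec-unique unique zero = [] ∷ []
allVec-unique {xs = xs} unique (suc n) = concatMap-prepend-unique (allVec xs n) (allVec-unique unique n) unique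

length-allVec : ∀ {A : Set} (xs : List A) n → length (allVec xs n) ≡ length xs ^ n
length-allVec xs zero = refl
length-allVec xs (suc n) =
  trans (length-concatMap-prepend (allVec xs n) xs) (cong (length xs ℕ.*_) (length-allVec xs n))

bits : List Bool
bits = false ∷ true ∷ []

bits-unique : Unique bits
bits-unique = ((λ ()) ∷ []) ∷ ([] ∷ [])

∈-bits : ∀ b → b ∈ bits
∈-bits false = here refl
∈-bits true = there (here refl)

injective⇒surjective : ∀ {A : Set} → DecidableEquality A → (xs : List A) → Unique xs → (∀ x → x ∈ xs) →
  (f : A → A) → (∀ {x y} → f x ≡ f y → x ≡ y) → ∀ y → ∃ λ x → f x ≡ y
injective⇒surjective _≟_ xs unique complete f f-injective y with DecMembership._∈?_ _≟_ y (lmap f xs)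
... | yes y∈fxs = let (x , _ , y≡fx) = ∈-map⁻ f y∈fxs in x , sym y≡fx
... | no y∉fxs = ⊥-elim (<-irrefl refl (subst (λ k → suc k ≤ length xs) (length-map f xs) too-long))
  where
  too-long : suc (length (lmap f xs)) ≤ length xs
  too-long = unique⇒length-≤ (¬Any⇒All¬ _ y∉fxs ∷ Unique.map⁺ f-injective unique) (λ {z} _ → complete z)

-- F₂ⁿ and ℤ₄ⁿ

⊕-comm : ∀ {n} (v w : Vec Bool n) → v ⊕ w ≡ w ⊕ v
⊕-comm = zipWith-comm xor-comm

⊕-self : ∀ {n} (v : Vec Bool n) → v ⊕ v ≡ replicate n false
⊕-self [] = refl
⊕-self (x ∷ v) = cong₂ _∷_ (xor-same x) (⊕-self v)

⊕-cancelʳ : ∀ {n} (v w : Vec Bool n) → (v ⊕ w) ⊕ w ≡ v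
⊕-cancelʳ {n} v w = begin
  (v ⊕ w) ⊕ w              ≡⟨ zipWith-assoc xor-assoc v w w ⟩
  v ⊕ (w ⊕ w)              ≡⟨ cong (v ⊕_) (⊕-self w) ⟩
  v ⊕ replicate n false    ≡⟨ zipWith-identityʳ xor-identityʳ v ⟩
  v                        ∎
  where open ≡-Reasoning

v⊕[w⊕v]≡w : ∀ {n} (v w : Vec Bool n) → v ⊕ (w ⊕ v) ≡ w
v⊕[w⊕v]≡w v w = trans (⊕-comm v (w ⊕ v)) (⊕-cancelʳ w v)

[v⊕w]⊕v≡w : ∀ {n} (v w : Vec Bool n) → (v ⊕ w) ⊕ v ≡ w
[v⊕w]⊕v≡w v w = trans (cong (_⊕ v) (⊕-comm v w)) (⊕-cancelʳ w v)

⊕-injectiveʳ : ∀ {n} (k : Vec Bool n) {v w} → v ⊕ k ≡ w ⊕ k → v ≡ w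
⊕-injectiveʳ k {v} {w} v⊕k≡w⊕k = trans (sym (⊕-cancelʳ v k)) (trans (cong (_⊕ k) v⊕k≡w⊕k) (⊕-cancelʳ w k))

⊕≡0⇒≡ : ∀ {n} (v w : Vec Bool n) → v ⊕ w ≡ replicate n false → v ≡ w
⊕≡0⇒≡ v w v⊕w≡0 = trans (sym (⊕-cancelʳ v w)) (trans (cong (_⊕ w) v⊕w≡0) (zipWith-identityˡ xor-identityˡ w))

-- The 2-adic digits of ℤ₄: x = digit₀ x + 2 digit₁ x, so ⌊ a , b ⌋ has digits a and b.
digit₀ : Z4 → Bool
digit₀ fz = false
digit₀ (fs fz) = true
digit₀ (fs (fs fz)) = false
digit₀ (fs (fs (fs fz))) = true

digit₁ : Z4 → Bool
digit₁ fz = false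
digit₁ (fs fz) = false
digit₁ (fs (fs fz)) = true
digit₁ (fs (fs (fs fz))) = true

digits₀ : ∀ {n} → Vec Z4 n → Vec Bool n
digits₀ = vmap digit₀

digits₁ : ∀ {n} → Vec Z4 n → Vec Bool n
digits₁ = vmap digit₁

digits₀-⌊⌋ : ∀ {n} (a b : Vec Bool n) → digits₀ ⌊ a , b ⌋ ≡ a
digits₀-⌊⌋ [] [] = refl
digits₀-⌊⌋ (false ∷ a) (false ∷ b) = cong (false ∷_) (digits₀-⌊⌋ a b)
digits₀-⌊⌋ (false ∷ a) (true ∷ b) = cong (false ∷_) (digits₀-⌊⌋ a b)
digits₀-⌊⌋ (true ∷ a) (false ∷ b) = cong (true ∷_) (digits₀-⌊⌋ a b)
digits₀-⌊⌋ (true ∷ a) (true ∷ b) = cong (true ∷_) (digits₀-⌊⌋ a b)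

digits₁-⌊⌋ : ∀ {n} (a b : Vec Bool n) → digits₁ ⌊ a , b ⌋ ≡ b
digits₁-⌊⌋ [] [] = refl
digits₁-⌊⌋ (false ∷ a) (false ∷ b) = cong (false ∷_) (digits₁-⌊⌋ a b)
digits₁-⌊⌋ (false ∷ a) (true ∷ b) = cong (true ∷_) (digits₁-⌊⌋ a b)
digits₁-⌊⌋ (true ∷ a) (false ∷ b) = cong (false ∷_) (digits₁-⌊⌋ a b)
digits₁-⌊⌋ (true ∷ a) (true ∷ b) = cong (true ∷_) (digits₁-⌊⌋ a b)

⌊digits⌋ : ∀ {n} (v : Vec Z4 n) → ⌊ digits₀ v , digits₁ v ⌋ ≡ v
⌊digits⌋ [] = refl
⌊digits⌋ (fz ∷ v) = cong (fz ∷_) (⌊digits⌋ v)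
⌊digits⌋ (fs fz ∷ v) = cong (fs fz ∷_) (⌊digits⌋ v)
⌊digits⌋ (fs (fs fz) ∷ v) = cong (fs (fs fz) ∷_) (⌊digits⌋ v)
⌊digits⌋ (fs (fs (fs fz)) ∷ v) = cong (fs (fs (fs fz)) ∷_) (⌊digits⌋ v)

⌊⌋-injective : ∀ {n} {a b a′ b′ : Vec Bool n} → ⌊ a , b ⌋ ≡ ⌊ a′ , b′ ⌋ → a ≡ a′ × b ≡ b′
⌊⌋-injective {a = a} {b} {a′} {b′} eq =
  trans (sym (digits₀-⌊⌋ a b)) (trans (cong digits₀ eq) (digits₀-⌊⌋ a′ b′)) ,
  trans (sym (digits₁-⌊⌋ a b)) (trans (cong digits₁ eq) (digits₁-⌊⌋ a′ b′))

-- The borrow of the low-digit subtraction x − y is y ∧ (x xor y).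
⌊⌋-difference : ∀ {n} (x p y q : Vec Bool n) → ⌊ x , p ⌋ -ᵥ ⌊ y , q ⌋ ≡ ⌊ x ⊕ y , (p ⊕ q) ⊕ (y ⊙ (x ⊕ y)) ⌋
⌊⌋-difference [] [] [] [] = refl
⌊⌋-difference (x ∷ xs) (p ∷ ps) (y ∷ ys) (q ∷ qs) = cong₂ _∷_ (digit x p y q) (⌊⌋-difference xs ps ys qs)
  where
  digit : ∀ x p y q → (ψ x +₄ (ψ p +₄ ψ p)) -₄ (ψ y +₄ (ψ q +₄ ψ q))
    ≡ ψ (x xor y) +₄ (ψ ((p xor q) xor (y ∧ (x xor y))) +₄ ψ ((p xor q) xor (y ∧ (x xor y))))
  digit true true true true = refl
  digit true true true false = refl
  digit true true false true = refl
  digit true true false false = refl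
  digit true false true true = refl
  digit true false true false = refl
  digit true false false true = refl
  digit true false false false = refl
  digit false true true true = refl
  digit false true true false = refl
  digit false true false true = refl
  digit false true false false = refl
  digit false false true true = refl
  digit false false true false = refl
  digit false false false true = refl
  digit false false false false = refl

-ᵥ-self : ∀ {n} (v : Vec Z4 n) → v -ᵥ v ≡ 0ᵥ
-ᵥ-self [] = refl
-ᵥ-self (fz ∷ v) = cong (fz ∷_) (-ᵥ-self v)
-ᵥ-self (fs fz ∷ v) = cong (fz ∷_) (-ᵥ-self v)
-ᵥ-self (fs (fs fz) ∷ v) = cong (fz ∷_) (-ᵥ-self v)
-ᵥ-self (fs (fs (fs fz)) ∷ v) = cong (fz ∷_) (-ᵥ-self v)

in2Z4⇒digits₀≡0 : ∀ {n} (v : Vec Z4 n) → in2Z4 v ≡ true → digits₀ v ≡ replicate n false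
in2Z4⇒digits₀≡0 [] _ = refl
in2Z4⇒digits₀≡0 (fz ∷ v) v∈2ℤ₄ⁿ = cong (false ∷_) (in2Z4⇒digits₀≡0 v v∈2ℤ₄ⁿ)
in2Z4⇒digits₀≡0 (fs (fs fz) ∷ v) v∈2ℤ₄ⁿ = cong (false ∷_) (in2Z4⇒digits₀≡0 v v∈2ℤ₄ⁿ)

in2Z4-⌊0,b⌋ : ∀ {n} (b : Vec Bool n) → in2Z4 ⌊ replicate n false , b ⌋ ≡ true
in2Z4-⌊0,b⌋ [] = refl
in2Z4-⌊0,b⌋ (false ∷ b) = in2Z4-⌊0,b⌋ b
in2Z4-⌊0,b⌋ (true ∷ b) = in2Z4-⌊0,b⌋ b

digits₀≡0⇒in2Z4 : ∀ {n} (v : Vec Z4 n) → digits₀ v ≡ replicate n false → in2Z4 v ≡ true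
digits₀≡0⇒in2Z4 v digits₀≡0 =
  subst (λ w → in2Z4 w ≡ true) (⌊digits⌋ v)
        (subst (λ a → in2Z4 ⌊ a , digits₁ v ⌋ ≡ true) (sym digits₀≡0) (in2Z4-⌊0,b⌋ (digits₁ v)))

in2Z4-⌊a,b⌋⇒a≡0 : ∀ {n} (a b : Vec Bool n) → in2Z4 ⌊ a , b ⌋ ≡ true → a ≡ replicate n false
in2Z4-⌊a,b⌋⇒a≡0 a b ∈2ℤ₄ⁿ = trans (sym (digits₀-⌊⌋ a b)) (in2Z4⇒digits₀≡0 _ ∈2ℤ₄ⁿ)

-- Relative difference sets

T-does⁻ : ∀ {P : Set} (P? : Dec P) → T (does P?) → P
T-does⁻ (yes p) _ = p

module _ {n : ℕ} where

  ∈-elems⁺ : (S : Subset n) {v : Vec Z4 n} → S v ≡ true → v ∈ elems S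
  ∈-elems⁺ S {v} v∈S = ∈-filter⁺ (λ w → T? (S w)) (∈-allVec ∈-allFin v) (Equivalence.from T-≡ v∈S)

  ∈-elems⁻ : (S : Subset n) {v : Vec Z4 n} → v ∈ elems S → S v ≡ true
  ∈-elems⁻ S v∈ = Equivalence.to T-≡ (proj₂ (∈-filter⁻ (λ w → T? (S w)) {xs = allZ4ⁿ n} v∈))

  elems-unique : (S : Subset n) → Unique (elems S)
  elems-unique S = Unique.filter⁺ (λ w → T? (S w)) (allVec-unique (Unique.allFin⁺ 4) n)

  card-image≡2^n : (S : Subset n) (f : Vec Bool n → Vec Z4 n) → (∀ {a a′} → f a ≡ f a′ → a ≡ a′) →
    (∀ a → S (f a) ≡ true) → (∀ v → S v ≡ true → ∃ λ a → v ≡ f a) → card S ≡ 2 ^ n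
  card-image≡2^n S f f-injective image⊆S S⊆image =
    trans (≤-antisym S≤image image≤S) (trans (length-map f (allVec bits n)) (length-allVec bits n))
    where
    S≤image : card S ≤ length (lmap f (allVec bits n))
    S≤image = unique⇒length-≤ (elems-unique S) λ {v} v∈S →
      let (a , v≡fa) = S⊆image v (∈-elems⁻ S v∈S) in subst (_∈ _) (sym v≡fa) (∈-map⁺ f (∈-allVec ∈-bits a))
    image≤S : length (lmap f (allVec bits n)) ≤ card S
    image≤S = unique⇒length-≤ (Unique.map⁺ f-injective (allVec-unique bits-unique n)) λ v∈image →
      let (a , _ , v≡fa) = ∈-map⁻ f v∈image in ∈-elems⁺ S (subst (λ v → S v ≡ true) (sym v≡fa) (image⊆S a))

4^n≡2^n*2^n : ∀ n → 4 ^ n ≡ 2 ^ n ℕ.* 2 ^ n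
4^n≡2^n*2^n n = trans (^-*-assoc 2 2 n) (trans (cong (λ k → 2 ^ (n ℕ.+ k)) (ℕₚ.+-identityʳ n)) (^-distribˡ-+-* 2 n n))

module RelativeDifferenceSet {n : ℕ} (D : Subset n) (transversal : IsTransversal D)
                             (h : Vec Bool n → Vec Bool n) (h-represents : IsF2Rep D h) where

  graph : Vec Bool n → Vec Z4 n
  graph x = ⌊ x , h x ⌋

  D⇒graph : ∀ v → D v ≡ true → v ≡ graph (digits₀ v)
  D⇒graph v v∈D =
    trans (sym (⌊digits⌋ v)) (cong (λ b → ⌊ a , b ⌋) (trans (unique (digits₁ v) ⌊a,b⌋∈D) (sym (unique (h a) (h-represents a)))))
    where
    a = digits₀ v
    unique = proj₂ (proj₂ (transversal a))
    ⌊a,b⌋∈D : D ⌊ a , digits₁ v ⌋ ≡ true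
    ⌊a,b⌋∈D = subst (λ w → D w ≡ true) (sym (⌊digits⌋ v)) v∈D

  graph-difference : ∀ x y → graph x -ᵥ graph y ≡ ⌊ x ⊕ y , Δ h (x ⊕ y) y ⌋
  graph-difference x y = trans (⌊⌋-difference x (h x) y (h y))
    (cong (λ z → ⌊ x ⊕ y , (h z ⊕ h y) ⊕ (y ⊙ (x ⊕ y)) ⌋) (sym (v⊕[w⊕v]≡w y x)))

  pairs : Vec Z4 n → List (Vec Z4 n × Vec Z4 n)
  pairs g = filterᵇ (λ p → does (≡-dec Fin._≟_ (proj₁ p -ᵥ proj₂ p) g)) (cartesianProduct (elems D) (elems D))

  pairs-unique : ∀ g → Unique (pairs g)
  pairs-unique g = Unique.filter⁺ _ (Unique.cartesianProduct⁺ (elems-unique D) (elems-unique D))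

  ∈-pairs⁺ : ∀ {a b} y → Δ h a y ≡ b → (graph (y ⊕ a) , graph y) ∈ pairs ⌊ a , b ⌋
  ∈-pairs⁺ {a} y Δy≡b =
    ∈-filter⁺ _ (∈-cartesianProduct⁺ (∈-elems⁺ D (h-represents _)) (∈-elems⁺ D (h-represents y)))
                (Equivalence.from T-≡ (dec-true (≡-dec Fin._≟_ _ _) difference))
    where
    difference : graph (y ⊕ a) -ᵥ graph y ≡ ⌊ a , _ ⌋
    difference = trans (graph-difference (y ⊕ a) y)
                       (trans (cong (λ a → ⌊ a , Δ h a y ⌋) ([v⊕w]⊕v≡w y a)) (cong (λ b → ⌊ a , b ⌋) Δy≡b))

  ∈-pairs⇒graphs : ∀ {g p} → p ∈ pairs g → ∃₂ λ x y → p ≡ (graph x , graph y) × graph x -ᵥ graph y ≡ g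
  ∈-pairs⇒graphs {g} {d , d′} p∈ =
    digits₀ d , digits₀ d′ , cong₂ _,_ d≡ d′≡ ,
    trans (sym (cong₂ _-ᵥ_ d≡ d′≡)) (T-does⁻ (≡-dec Fin._≟_ _ _) (proj₂ p∈cart))
    where
    p∈cart = ∈-filter⁻ _ {xs = cartesianProduct (elems D) (elems D)} p∈
    d∈×d′∈ = ∈-cartesianProduct⁻ (elems D) (elems D) (proj₁ p∈cart)
    d≡ = D⇒graph d (∈-elems⁻ D (proj₁ d∈×d′∈))
    d′≡ = D⇒graph d′ (∈-elems⁻ D (proj₂ d∈×d′∈))

  ∈-pairs⁻ : ∀ {a b p} → p ∈ pairs ⌊ a , b ⌋ → ∃ λ y → p ≡ (graph (y ⊕ a) , graph y) × Δ h a y ≡ b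
  ∈-pairs⁻ {a} {b} p∈ with ∈-pairs⇒graphs p∈
  ... | x , y , p≡ , difference with ⌊⌋-injective (trans (sym (graph-difference x y)) difference)
  ... | refl , Δy≡b = y , trans p≡ (cong (λ x → graph x , graph y) (sym (v⊕[w⊕v]≡w y x))) , Δy≡b

  IsRDS₁ : Set
  IsRDS₁ = IsRDS n (2 ^ n) (2 ^ n) (2 ^ n) 1 in2Z4 D

  AllΔBijective : Set
  AllΔBijective = ∀ a → a ≢ replicate n false → Bijective _≡_ _≡_ (Δ h a)

  rds⇒Δ-bijective : IsRDS₁ → AllΔBijective
  rds⇒Δ-bijective (_ , _ , _ , reps≡1 , _) a a≢0 = injective , surjective
    where
    one-pair : ∀ b → length (pairs ⌊ a , b ⌋) ≡ 1
    one-pair b = reps≡1 ⌊ a , b ⌋ (¬-not (λ ⌊a,b⌋∈2ℤ₄ⁿ → a≢0 (in2Z4-⌊a,b⌋⇒a≡0 a b ⌊a,b⌋∈2ℤ₄ⁿ)))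
    injective : ∀ {y y′} → Δ h a y ≡ Δ h a y′ → y ≡ y′
    injective {y} {y′} Δy≡Δy′ =
      proj₁ (⌊⌋-injective (cong proj₂
        (length≡1⇒∈-unique _ (one-pair _) (∈-pairs⁺ y refl) (∈-pairs⁺ y′ (sym Δy≡Δy′)))))
    surjective : ∀ b → ∃ λ y → ∀ {z} → z ≡ y → Δ h a z ≡ b
    surjective b with ∈-pairs⁻ (proj₂ (length≡1⇒∃∈ _ (one-pair b)))
    ... | y , _ , Δy≡b = y , λ { refl → Δy≡b }

  Δ-bijective⇒rds : AllΔBijective → IsRDS₁
  Δ-bijective⇒rds Δ-bijective = 4^n≡2^n*2^n n , card-2ℤ₄ⁿ , card-D , reps≡1 , reps≡0
    where
    card-2ℤ₄ⁿ : card {n} in2Z4 ≡ 2 ^ n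
    card-2ℤ₄ⁿ = card-image≡2^n in2Z4 (λ b → ⌊ replicate n false , b ⌋) (λ eq → proj₂ (⌊⌋-injective eq)) in2Z4-⌊0,b⌋
      λ v v∈2ℤ₄ⁿ → digits₁ v ,
        trans (sym (⌊digits⌋ v)) (cong (λ a → ⌊ a , digits₁ v ⌋) (in2Z4⇒digits₀≡0 v v∈2ℤ₄ⁿ))

    card-D : card D ≡ 2 ^ n
    card-D = card-image≡2^n D graph (λ eq → proj₁ (⌊⌋-injective eq)) h-represents λ v v∈D → digits₀ v , D⇒graph v v∈D

    one-pair : ∀ a b → a ≢ replicate n false → length (pairs ⌊ a , b ⌋) ≡ 1
    one-pair a b a≢0 = singleton⇒length≡1 (pairs-unique _) (∈-pairs⁺ y Δy≡b) only-pair
      where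
      y = proj₁ (proj₂ (Δ-bijective a a≢0) b)
      Δy≡b = proj₂ (proj₂ (Δ-bijective a a≢0) b) refl
      only-pair : ∀ {p} → p ∈ pairs ⌊ a , b ⌋ → p ≡ (graph (y ⊕ a) , graph y)
      only-pair p∈ with ∈-pairs⁻ p∈
      ... | y′ , p≡ , Δy′≡b =
        trans p≡ (cong (λ z → graph (z ⊕ a) , graph z) (proj₁ (Δ-bijective a a≢0) (trans Δy′≡b (sym Δy≡b))))

    reps≡1 : ∀ g → in2Z4 g ≡ false → reps D g ≡ 1
    reps≡1 g g∉2ℤ₄ⁿ = subst (λ g → length (pairs g) ≡ 1) (⌊digits⌋ g) (one-pair (digits₀ g) (digits₁ g) a≢0)
      where
      a≢0 : digits₀ g ≢ replicate n false
      a≢0 a≡0 with trans (sym g∉2ℤ₄ⁿ) (digits₀≡0⇒in2Z4 g a≡0)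
      ... | ()

    reps≡0 : ∀ g → in2Z4 g ≡ true → g ≢ 0ᵥ → reps D g ≡ 0
    reps≡0 g g∈2ℤ₄ⁿ g≢0 = empty⇒length≡0 (pairs g) λ p∈ → g≢0 (zero-difference p∈)
      where
      zero-difference : ∀ {p} → p ∈ pairs g → g ≡ 0ᵥ
      zero-difference p∈ with ∈-pairs⇒graphs p∈
      ... | x , y , _ , difference =
        trans (sym difference) (trans (cong (λ x → graph x -ᵥ graph y) x≡y) (-ᵥ-self (graph y)))
        where
        x⊕y≡0 : x ⊕ y ≡ replicate n false
        x⊕y≡0 = in2Z4-⌊a,b⌋⇒a≡0 (x ⊕ y) _
                  (subst (λ w → in2Z4 w ≡ true) (sym (trans (sym (graph-difference x y)) difference)) g∈2ℤ₄ⁿ)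
        x≡y = ⊕≡0⇒≡ x y x⊕y≡0

  rds⇔Δ-bijective : IsRDS₁ ⇔ AllΔBijective
  rds⇔Δ-bijective = mk⇔ rds⇒Δ-bijective Δ-bijective⇒rds

-- Sums and the quadratic map μ

module Sums {c ℓ : Level} (R : CommutativeRing c ℓ) where

  open CommutativeRing R renaming (refl to ≈-refl; sym to ≈-sym; trans to ≈-trans; zero to *-zero)
  open import Algebra.Properties.Semiring.Sum semiring public using (sum; sum-syntax; sum-cong-≋; ∑-distrib-+; *-distribˡ-sum)
  open import Relation.Binary.Reasoning.Setoid setoid
  open import Algebra.Solver.Ring.NaturalCoefficients.Default commutativeSemiring using (solve; _:=_; _:+_; _:*_)

  sumUpper : ∀ n → (Fin n → Fin n → Carrier) → Carrier
  sumUpper zero G = 0#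
  sumUpper (suc n) G = ∑[ j < n ] G fz (fs j) + sumUpper n (λ i j → G (fs i) (fs j))

  sumUpper-cong : ∀ n {G H : Fin n → Fin n → Carrier} → (∀ i j → G i j ≈ H i j) → sumUpper n G ≈ sumUpper n H
  sumUpper-cong zero G≈H = ≈-refl
  sumUpper-cong (suc n) G≈H = +-cong (sum-cong-≋ (λ j → G≈H fz (fs j))) (sumUpper-cong n (λ i j → G≈H (fs i) (fs j)))

  sumUpper-distrib-+ : ∀ n (G H : Fin n → Fin n → Carrier) →
    sumUpper n (λ i j → G i j + H i j) ≈ sumUpper n G + sumUpper n H
  sumUpper-distrib-+ zero G H = ≈-sym (+-identityˡ 0#)
  sumUpper-distrib-+ (suc n) G H = begin
    ∑[ j < n ] (G fz (fs j) + H fz (fs j)) + sumUpper n (λ i j → G (fs i) (fs j) + H (fs i) (fs j))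
      ≈⟨ +-cong (∑-distrib-+ (λ j → G fz (fs j)) (λ j → H fz (fs j))) (sumUpper-distrib-+ n _ _) ⟩
    (∑G₀ + ∑H₀) + (sumUpper n G′ + sumUpper n H′)
      ≈⟨ solve 4 (λ a b c d → (a :+ b) :+ (c :+ d) := (a :+ c) :+ (b :+ d)) ≈-refl ∑G₀ ∑H₀ _ _ ⟩
    (∑G₀ + sumUpper n G′) + (∑H₀ + sumUpper n H′) ∎
    where
    ∑G₀ = ∑[ j < n ] G fz (fs j)
    ∑H₀ = ∑[ j < n ] H fz (fs j)
    G′ = λ i j → G (fs i) (fs j)
    H′ = λ i j → H (fs i) (fs j)

  sumUpper-indicator : ∀ n (G : Fin n → Fin n → Carrier) →
    ∑[ i < n ] ∑[ j < n ] (if does (Fin.toℕ i ℕ.<? Fin.toℕ j) then G i j else 0#) ≈ sumUpper n G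
  sumUpper-indicator zero G = ≈-refl
  sumUpper-indicator (suc n) G =
    +-cong (+-identityˡ _) (≈-trans (sum-cong-≋ {n} (λ i → +-identityˡ _)) (sumUpper-indicator n (λ i j → G (fs i) (fs j))))

  ∑*∑ : ∀ n (U W : Fin n → Carrier) →
    sum U * sum W ≈ ∑[ i < n ] (U i * W i) + sumUpper n (λ i j → U i * W j + W i * U j)
  ∑*∑ zero U W = ≈-trans (*-zero .proj₁ 0#) (≈-sym (+-identityˡ 0#))
  ∑*∑ (suc n) U W = begin
    (U₀ + ∑U) * (W₀ + ∑W)
      ≈⟨ solve 4 (λ u w su sw → (u :+ su) :* (w :+ sw) := (u :* w :+ su :* sw) :+ (u :* sw :+ w :* su)) ≈-refl U₀ W₀ ∑U ∑W ⟩
    (U₀ * W₀ + ∑U * ∑W) + (U₀ * ∑W + W₀ * ∑U)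
      ≈⟨ +-cong (+-congˡ (∑*∑ n (λ i → U (fs i)) (λ i → W (fs i)))) row ⟩
    (U₀ * W₀ + (∑UW + upper)) + ∑[ j < n ] (U₀ * W (fs j) + W₀ * U (fs j))
      ≈⟨ solve 4 (λ a b c d → (a :+ (b :+ c)) :+ d := (a :+ b) :+ (d :+ c)) ≈-refl (U₀ * W₀) ∑UW upper _ ⟩
    (U₀ * W₀ + ∑UW) + (∑[ j < n ] (U₀ * W (fs j) + W₀ * U (fs j)) + upper) ∎
    where
    U₀ = U fz
    W₀ = W fz
    ∑U = ∑[ i < n ] U (fs i)
    ∑W = ∑[ i < n ] W (fs i)
    ∑UW = ∑[ i < n ] (U (fs i) * W (fs i))
    upper = sumUpper n (λ i j → U (fs i) * W (fs j) + W (fs i) * U (fs j))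
    row : U₀ * ∑W + W₀ * ∑U ≈ ∑[ j < n ] (U₀ * W (fs j) + W₀ * U (fs j))
    row = ≈-trans (+-cong (*-distribˡ-sum U₀ (λ j → W (fs j))) (*-distribˡ-sum W₀ (λ j → U (fs j))))
                  (≈-sym (∑-distrib-+ (λ j → U₀ * W (fs j)) (λ j → W₀ * U (fs j))))

  sumF-++ : ∀ (xs ys : List Carrier) → sumF R (xs List.++ ys) ≈ sumF R xs + sumF R ys
  sumF-++ [] ys = ≈-sym (+-identityˡ _)
  sumF-++ (x ∷ xs) ys = ≈-trans (+-congˡ (sumF-++ xs ys)) (≈-sym (+-assoc _ _ _))

  sumF-tabulate : ∀ n (f : Fin n → Carrier) → sumF R (List.tabulate f) ≡ sum f
  sumF-tabulate zero f = refl
  sumF-tabulate (suc n) f = cong (f fz +_) (sumF-tabulate n (λ i → f (fs i)))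

  sumF-map-allFin : ∀ n (f : Fin n → Carrier) → sumF R (lmap f (List.allFin n)) ≡ sum f
  sumF-map-allFin n f = trans (cong (sumF R) (map-tabulate (λ i → i) f)) (sumF-tabulate n f)

  sumF-map-filterᵇ : ∀ {A : Set} (f : A → Carrier) (p : A → Bool) (xs : List A) →
    sumF R (lmap f (filterᵇ p xs)) ≈ sumF R (lmap (λ x → if p x then f x else 0#) xs)
  sumF-map-filterᵇ f p [] = ≈-refl
  sumF-map-filterᵇ f p (x ∷ xs) with p x
  ... | true = +-congˡ (sumF-map-filterᵇ f p xs)
  ... | false = ≈-trans (sumF-map-filterᵇ f p xs) (≈-sym (+-identityˡ _))

  sumF-map-cartesianProduct : ∀ {A B : Set} (f : A × B → Carrier) (xs : List A) (ys : List B) →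
    sumF R (lmap f (cartesianProduct xs ys)) ≈ sumF R (lmap (λ x → sumF R (lmap (λ y → f (x , y)) ys)) xs)
  sumF-map-cartesianProduct f [] ys = ≈-refl
  sumF-map-cartesianProduct f (x ∷ xs) ys = begin
    sumF R (lmap f (lmap (x ,_) ys List.++ cartesianProduct xs ys))
      ≡⟨ cong (sumF R) (map-++ f (lmap (x ,_) ys) _) ⟩
    sumF R (lmap f (lmap (x ,_) ys) List.++ lmap f (cartesianProduct xs ys))
      ≈⟨ sumF-++ (lmap f (lmap (x ,_) ys)) (lmap f (cartesianProduct xs ys)) ⟩
    sumF R (lmap f (lmap (x ,_) ys)) + sumF R (lmap f (cartesianProduct xs ys))
      ≡⟨ cong (_+ _) (cong (sumF R) (sym (map-∘ ys))) ⟩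
    sumF R (lmap (λ y → f (x , y)) ys) + sumF R (lmap f (cartesianProduct xs ys))
      ≈⟨ +-congˡ (sumF-map-cartesianProduct f xs ys) ⟩
    sumF R (lmap (λ y → f (x , y)) ys) + sumF R (lmap (λ x → sumF R (lmap (λ y → f (x , y)) ys)) xs) ∎

module CharacteristicTwo {c ℓ : Level} (R : CommutativeRing c ℓ) (char2 : Char2 R) where

  open CommutativeRing R renaming (refl to ≈-refl; sym to ≈-sym; trans to ≈-trans; zero to *-zero)
  open Sums R
  open import Relation.Binary.Reasoning.Setoid setoid
  open import Algebra.Solver.Ring.NaturalCoefficients.Default commutativeSemiring using (solve; _:=_; _:+_; _:*_)

  x+x≈0 : ∀ x → x + x ≈ 0#
  x+x≈0 x = begin
    x + x              ≈⟨ +-cong (≈-sym (*-identityˡ x)) (≈-sym (*-identityˡ x)) ⟩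
    1# * x + 1# * x    ≈⟨ ≈-sym (distribʳ x 1# 1#) ⟩
    (1# + 1#) * x      ≈⟨ *-congʳ char2 ⟩
    0# * x             ≈⟨ *-zero .proj₁ x ⟩
    0#                 ∎

  x+y+y≈x : ∀ x y → (x + y) + y ≈ x
  x+y+y≈x x y = ≈-trans (+-assoc x y y) (≈-trans (+-congˡ (x+x≈0 y)) (+-identityʳ x))

  infix 8 _²
  _² : Carrier → Carrier
  x ² = x * x

  ²-distrib-+ : ∀ x y → (x + y) ² ≈ x ² + y ²
  ²-distrib-+ x y = begin
    (x + y) * (x + y)                  ≈⟨ solve 2 (λ x y → (x :+ y) :* (x :+ y) := (x :* x :+ y :* y) :+ (x :* y :+ x :* y)) ≈-refl x y ⟩
    (x * x + y * y) + (x * y + x * y)  ≈⟨ +-congˡ (x+x≈0 _) ⟩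
    (x * x + y * y) + 0#               ≈⟨ +-identityʳ _ ⟩
    x * x + y * y                      ∎

  ²-distrib-sum : ∀ n (f : Fin n → Carrier) → (sum f) ² ≈ ∑[ i < n ] (f i ²)
  ²-distrib-sum zero f = *-zero .proj₁ 0#
  ²-distrib-sum (suc n) f = ≈-trans (²-distrib-+ _ _) (+-congˡ (²-distrib-sum n (λ i → f (fs i))))

  cross-terms : ∀ a b c d → ((a + b) * (c + d) + a * c) + b * d ≈ a * d + b * c
  cross-terms a b c d = begin
    ((a + b) * (c + d) + a * c) + b * d
      ≈⟨ solve 4 (λ a b c d → ((a :+ b) :* (c :+ d) :+ a :* c) :+ b :* d
                              := (a :* d :+ b :* c) :+ ((a :* c :+ a :* c) :+ (b :* d :+ b :* d))) ≈-refl a b c d ⟩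
    (a * d + b * c) + ((a * c + a * c) + (b * d + b * d))  ≈⟨ +-congˡ (≈-trans (+-cong (x+x≈0 _) (x+x≈0 _)) (+-identityˡ 0#)) ⟩
    (a * d + b * c) + 0#                                   ≈⟨ +-identityʳ _ ⟩
    a * d + b * c                                          ∎

  select : Bool → Carrier → Carrier
  select b x = if b then x else 0#

  select-cong : ∀ b {x y} → x ≈ y → select b x ≈ select b y
  select-cong true x≈y = x≈y
  select-cong false _ = ≈-refl

  select-xor : ∀ a b x → select (a xor b) x ≈ select a x + select b x
  select-xor true true x = ≈-sym (x+x≈0 x)
  select-xor true false x = ≈-sym (+-identityʳ x)
  select-xor false true x = ≈-sym (+-identityˡ x)
  select-xor false false x = ≈-sym (+-identityˡ 0#)

  select-∧-* : ∀ a b x y → select (a ∧ b) (x * y) ≈ select a x * select b y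
  select-∧-* true true x y = ≈-refl
  select-∧-* true false x y = ≈-sym (*-zero .proj₂ x)
  select-∧-* false true x y = ≈-sym (*-zero .proj₁ y)
  select-∧-* false false x y = ≈-sym (*-zero .proj₁ 0#)

  select-∧-² : ∀ a b x → (select (a ∧ b) x) ² ≈ select a x * select b x
  select-∧-² true true x = ≈-refl
  select-∧-² true false x = ≈-trans (*-zero .proj₁ 0#) (≈-sym (*-zero .proj₂ x))
  select-∧-² false true x = ≈-trans (*-zero .proj₁ 0#) (≈-sym (*-zero .proj₁ x))
  select-∧-² false false x = ≈-refl

  component : ∀ {n} → Vec Carrier n → Vec Bool n → Fin n → Carrier
  component ξ v i = select (lookup v i) (lookup ξ i)

  coord≈sum : ∀ {n} (ξ : Vec Carrier n) v → coord R ξ v ≈ sum (component ξ v)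
  coord≈sum [] [] = ≈-refl
  coord≈sum (x ∷ ξ) (b ∷ v) = +-congˡ (coord≈sum ξ v)

  component-⊕ : ∀ {n} (ξ : Vec Carrier n) v w i → component ξ (v ⊕ w) i ≈ component ξ v i + component ξ w i
  component-⊕ ξ v w i rewrite lookup-zipWith _xor_ i v w = select-xor (lookup v i) (lookup w i) (lookup ξ i)

  component-⊙ : ∀ {n} (ξ : Vec Carrier n) v w i → component ξ (v ⊙ w) i ≡ select (lookup v i ∧ lookup w i) (lookup ξ i)
  component-⊙ ξ v w i rewrite lookup-zipWith _∧_ i v w = refl

  coord-⊕ : ∀ {n} (ξ : Vec Carrier n) v w → coord R ξ (v ⊕ w) ≈ coord R ξ v + coord R ξ w
  coord-⊕ {n} ξ v w = begin
    coord R ξ (v ⊕ w)                                ≈⟨ coord≈sum ξ _ ⟩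
    sum (component ξ (v ⊕ w))                        ≈⟨ sum-cong-≋ (component-⊕ ξ v w) ⟩
    ∑[ i < n ] (component ξ v i + component ξ w i)   ≈⟨ ∑-distrib-+ (component ξ v) (component ξ w) ⟩
    sum (component ξ v) + sum (component ξ w)        ≈⟨ +-cong (≈-sym (coord≈sum ξ v)) (≈-sym (coord≈sum ξ w)) ⟩
    coord R ξ v + coord R ξ w                        ∎

  coord-0 : ∀ {n} (ξ : Vec Carrier n) → coord R ξ (replicate n false) ≈ 0#
  coord-0 [] = ≈-refl
  coord-0 (x ∷ ξ) = ≈-trans (+-identityˡ _) (coord-0 ξ)

  μ : ∀ {n} → Vec Carrier n → Vec Bool n → Carrier
  μ {n} ξ v = sumUpper n (λ i j → component ξ v i * component ξ v j)

  μ-polar : ∀ {n} (ξ : Vec Carrier n) v w →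
    ((μ ξ (v ⊕ w) + μ ξ v) + μ ξ w) + coord R ξ v * coord R ξ w ≈ (coord R ξ (v ⊙ w)) ²
  μ-polar {n} ξ v w = begin
    ((μ ξ (v ⊕ w) + μ ξ v) + μ ξ w) + coord R ξ v * coord R ξ w
      ≈⟨ +-cong (≈-trans (+-congʳ (≈-sym (sumUpper-distrib-+ n _ _))) (≈-sym (sumUpper-distrib-+ n _ _)))
                (*-cong (coord≈sum ξ v) (coord≈sum ξ w)) ⟩
    sumUpper n (λ i j → (s i * s j + u i * u j) + u′ i * u′ j) + sum u * sum u′
      ≈⟨ +-cong (sumUpper-cong n cross) (∑*∑ n u u′) ⟩
    upper + (∑[ i < n ] (u i * u′ i) + upper)
      ≈⟨ ≈-trans (+-comm _ _) (x+y+y≈x _ upper) ⟩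
    ∑[ i < n ] (u i * u′ i)
      ≈⟨ sum-cong-≋ (λ i → ≈-sym (≈-trans (reflexive (cong _² (component-⊙ ξ v w i)))
                                          (select-∧-² (lookup v i) (lookup w i) (lookup ξ i)))) ⟩
    ∑[ i < n ] (component ξ (v ⊙ w) i ²)
      ≈⟨ ≈-sym (²-distrib-sum n _) ⟩
    (sum (component ξ (v ⊙ w))) ²
      ≈⟨ ≈-sym (*-cong (coord≈sum ξ (v ⊙ w)) (coord≈sum ξ (v ⊙ w))) ⟩
    (coord R ξ (v ⊙ w)) ² ∎
    where
    s = component ξ (v ⊕ w)
    u = component ξ v
    u′ = component ξ w
    upper = sumUpper n (λ i j → u i * u′ j + u′ i * u j)
    cross : ∀ i j → (s i * s j + u i * u j) + u′ i * u′ j ≈ u i * u′ j + u′ i * u j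
    cross i j = ≈-trans (+-congʳ (+-congʳ (*-cong (component-⊕ ξ v w i) (component-⊕ ξ v w j)))) (cross-terms _ _ _ _)

-- Fields with a basis over F₂

module _ {a c ℓ : Level} {A : Set a} {S : Setoid c ℓ} where

  open Setoid S renaming (refl to ≈-refl; sym to ≈-sym; trans to ≈-trans)

  sandwich-bijective⇔ : (E : Bijection (≡.setoid A) S) (D : Bijection S (≡.setoid A)) (f : A → A) (g : Carrier → Carrier) →
    (∀ x → g x ≈ Bijection.to E (f (Bijection.to D x))) → Bijective _≡_ _≡_ f ⇔ Bijective _≈_ _≈_ g
  sandwich-bijective⇔ E D f g g≈EfD = mk⇔ to from
    where
    module E = Bijection E
    module D = Bijection D

    to : Bijective _≡_ _≡_ f → Bijective _≈_ _≈_ g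
    to (f-injective , f-surjective) = g-injective , g-surjective
      where
      g-injective : ∀ {x y} → g x ≈ g y → x ≈ y
      g-injective {x} {y} gx≈gy = D.injective (f-injective (E.injective (≈-trans (≈-sym (g≈EfD x)) (≈-trans gx≈gy (g≈EfD y)))))
      g-surjective : ∀ y → ∃ λ x → ∀ {z} → z ≈ x → g z ≈ y
      g-surjective y = x , λ {z} z≈x →
        ≈-trans (g≈EfD z) (≈-trans (reflexive (cong E.to (trans (cong f (trans (D.cong z≈x) Dx≡w)) fw≡u))) Eu≈y)
        where
        u = proj₁ (E.strictlySurjective y)
        Eu≈y = proj₂ (E.strictlySurjective y)
        w = proj₁ (f-surjective u)
        fw≡u = proj₂ (f-surjective u) refl
        x = proj₁ (D.strictlySurjective w)
        Dx≡w = proj₂ (D.strictlySurjective w)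

    from : Bijective _≈_ _≈_ g → Bijective _≡_ _≡_ f
    from (g-injective , g-surjective) = f-injective , f-surjective
      where
      f-injective : ∀ {u v} → f u ≡ f v → u ≡ v
      f-injective {u} {v} fu≡fv = trans (sym Dx≡u) (trans (D.cong (g-injective gx≈gy)) Dy≡v)
        where
        x = proj₁ (D.strictlySurjective u)
        Dx≡u = proj₂ (D.strictlySurjective u)
        y = proj₁ (D.strictlySurjective v)
        Dy≡v = proj₂ (D.strictlySurjective v)
        gx≈gy : g x ≈ g y
        gx≈gy = ≈-trans (g≈EfD x) (≈-trans (reflexive (cong E.to (trans (cong f Dx≡u) (trans fu≡fv (cong f (sym Dy≡v))))))
                  (≈-sym (g≈EfD y)))
      f-surjective : ∀ b → ∃ λ u → ∀ {w} → w ≡ u → f w ≡ b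
      f-surjective b = D.to x , λ { refl → E.injective (≈-trans (≈-sym (g≈EfD x)) gx≈Eb) }
        where
        x = proj₁ (g-surjective (E.to b))
        gx≈Eb = proj₂ (g-surjective (E.to b)) ≈-refl

module FieldWithBasis {c ℓ : Level} (F : CommutativeRing c ℓ) (isField : IsField F) (char2 : Char2 F)
                      {n : ℕ} (B : Basis F n) where

  open CommutativeRing F renaming (refl to ≈-refl; sym to ≈-sym; trans to ≈-trans; zero to *-zero)
  open Basis B
  open Sums F
  open CharacteristicTwo F char2
  open import Relation.Binary.Reasoning.Setoid setoid
  open import Algebra.Solver.Ring.NaturalCoefficients.Default commutativeSemiring using (solve; _:=_; _:+_; _:*_)

  toF : Vec Bool n → Carrier
  toF = coord F ξ

  toF-injective : ∀ {v w} → toF v ≈ toF w → v ≡ w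
  toF-injective = proj₁ bij

  toF-coords : ∀ x → toF (coords x) ≈ x
  toF-coords x = proj₂ (proj₂ bij x) refl

  coords-toF : ∀ v → coords (toF v) ≡ v
  coords-toF v = toF-injective (toF-coords (toF v))

  coords-cong : ∀ {x y} → x ≈ y → coords x ≡ coords y
  coords-cong {x} {y} x≈y = toF-injective (≈-trans (toF-coords x) (≈-trans x≈y (≈-sym (toF-coords y))))

  coords-injective : ∀ {x y} → coords x ≡ coords y → x ≈ y
  coords-injective {x} {y} eq = ≈-trans (≈-sym (toF-coords x)) (≈-trans (reflexive (cong toF eq)) (toF-coords y))

  coords-+ : ∀ x y → coords (x + y) ≡ coords x ⊕ coords y
  coords-+ x y = toF-injective (begin
    toF (coords (x + y))                ≈⟨ toF-coords (x + y) ⟩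
    x + y                               ≈⟨ +-cong (≈-sym (toF-coords x)) (≈-sym (toF-coords y)) ⟩
    toF (coords x) + toF (coords y)     ≈⟨ ≈-sym (coord-⊕ ξ _ _) ⟩
    toF (coords x ⊕ coords y)           ∎)

  coords≡0⇒≈0 : ∀ {x} → coords x ≡ replicate n false → x ≈ 0#
  coords≡0⇒≈0 {x} eq = ≈-trans (≈-sym (toF-coords x)) (≈-trans (reflexive (cong toF eq)) (coord-0 ξ))

  _≈?_ : ∀ x y → Dec (x ≈ y)
  x ≈? y with ≡-dec _≟ᵇ_ (coords x) (coords y)
  ... | yes eq = yes (coords-injective eq)
  ... | no neq = no (λ x≈y → neq (coords-cong x≈y))

  x²≈0⇒x≈0 : ∀ x → x ² ≈ 0# → x ≈ 0#
  x²≈0⇒x≈0 x x²≈0 with x ≈? 0#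
  ... | yes x≈0 = x≈0
  ... | no x≉0 = contradiction 1≈0 (proj₁ isField)
    where
    y = proj₁ (proj₂ isField x x≉0)
    xy≈1 = proj₂ (proj₂ isField x x≉0)
    1≈0 : 1# ≈ 0#
    1≈0 = begin
      1#                   ≈⟨ ≈-sym (*-identityˡ 1#) ⟩
      1# * 1#              ≈⟨ ≈-sym (*-cong xy≈1 xy≈1) ⟩
      (x * y) * (x * y)    ≈⟨ solve 2 (λ x y → (x :* y) :* (x :* y) := (x :* x) :* (y :* y)) ≈-refl x y ⟩
      x ² * (y * y)        ≈⟨ *-congʳ x²≈0 ⟩
      0# * (y * y)         ≈⟨ *-zero .proj₁ _ ⟩
      0#                   ∎

  ²-injective : ∀ {x y} → x ² ≈ y ² → x ≈ y
  ²-injective {x} {y} x²≈y² = begin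
    x              ≈⟨ ≈-sym (x+y+y≈x x y) ⟩
    (x + y) + y    ≈⟨ +-congʳ x+y≈0 ⟩
    0# + y         ≈⟨ +-identityˡ y ⟩
    y              ∎
    where
    x+y≈0 : x + y ≈ 0#
    x+y≈0 = x²≈0⇒x≈0 (x + y) (≈-trans (²-distrib-+ x y) (≈-trans (+-congʳ x²≈y²) (x+x≈0 _)))

  toF²-surjective : ∀ y → ∃ λ v → toF v ² ≈ y
  toF²-surjective y with injective⇒surjective (≡-dec _≟ᵇ_) (allVec bits n) (allVec-unique bits-unique n) (∈-allVec ∈-bits)
                           (λ v → coords (toF v ²)) (λ eq → toF-injective (²-injective (coords-injective eq))) (coords y)
  ... | v , eq = v , coords-injective eq

  μB≈μ : ∀ x → μB x ≈ μ ξ (coords x)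
  μB≈μ x = begin
    μB x
      ≈⟨ sumF-map-filterᵇ term below (cartesianProduct (List.allFin n) (List.allFin n)) ⟩
    sumF F (lmap (λ p → select (below p) (term p)) (cartesianProduct (List.allFin n) (List.allFin n)))
      ≈⟨ sumF-map-cartesianProduct _ (List.allFin n) (List.allFin n) ⟩
    sumF F (lmap (λ i → sumF F (lmap (λ j → select (below (i , j)) (term (i , j))) (List.allFin n))) (List.allFin n))
      ≡⟨ sumF-map-allFin n _ ⟩
    ∑[ i < n ] sumF F (lmap (λ j → select (below (i , j)) (term (i , j))) (List.allFin n))
      ≈⟨ sum-cong-≋ {n} (λ i → reflexive (sumF-map-allFin n (λ j → select (below (i , j)) (term (i , j))))) ⟩
    ∑[ i < n ] ∑[ j < n ] select (below (i , j)) (term (i , j))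
      ≈⟨ sum-cong-≋ (λ i → sum-cong-≋ (λ j → select-cong (below (i , j)) (select-∧-* _ _ _ _))) ⟩
    ∑[ i < n ] ∑[ j < n ] select (below (i , j)) (component ξ v i * component ξ v j)
      ≈⟨ sumUpper-indicator n _ ⟩
    μ ξ v ∎
    where
    v = coords x
    below : Fin n × Fin n → Bool
    below (i , j) = does (Fin.toℕ i ℕ.<? Fin.toℕ j)
    term : Fin n × Fin n → Carrier
    term (i , j) = select (lookup v i ∧ lookup v j) (lookup ξ i * lookup ξ j)

  module _ (h : Vec Bool n → Vec Bool n) where

    fB≈ : ∀ x {v} → coords x ≡ v → fB h x ≈ toF (h v) ² + μ ξ v
    fB≈ x refl = +-congˡ (μB≈μ x)

    ∇-square : ∀ a x → ∇ h a x ≈ toF (Δ h (coords a) (coords x) ⊕ h (coords a)) ²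
    ∇-square a x = begin
      ∇ h a x
        ≈⟨ +-cong (+-cong (+-cong (fB≈ (x + a) (coords-+ x a)) (fB≈ x refl)) (fB≈ a refl))
                  (*-cong (≈-sym (toF-coords x)) (≈-sym (toF-coords a))) ⟩
      (((P ² + μ ξ (X ⊕ A)) + (Q ² + μ ξ X)) + (R ² + μ ξ A)) + toF X * toF A
        ≈⟨ solve 8 (λ p q r m₁ m₂ m₃ x a → (((p :+ m₁) :+ (q :+ m₂)) :+ (r :+ m₃)) :+ x :* a
                                          := ((p :+ q) :+ r) :+ (((m₁ :+ m₂) :+ m₃) :+ x :* a))
                   ≈-refl (P ²) (Q ²) (R ²) (μ ξ (X ⊕ A)) (μ ξ X) (μ ξ A) (toF X) (toF A) ⟩
      ((P ² + Q ²) + R ²) + (((μ ξ (X ⊕ A) + μ ξ X) + μ ξ A) + toF X * toF A)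
        ≈⟨ +-congˡ (μ-polar ξ X A) ⟩
      ((P ² + Q ²) + R ²) + W ²
        ≈⟨ solve 4 (λ p q r w → ((p :+ q) :+ r) :+ w := ((p :+ q) :+ w) :+ r) ≈-refl (P ²) (Q ²) (R ²) (W ²) ⟩
      ((P ² + Q ²) + W ²) + R ²
        ≈⟨ ≈-sym (≈-trans (²-distrib-+ _ _) (+-congʳ (≈-trans (²-distrib-+ _ _) (+-congʳ (²-distrib-+ _ _))))) ⟩
      (((P + Q) + W) + R) ²
        ≈⟨ ≈-sym (*-cong Δ⊕hA≈ Δ⊕hA≈) ⟩
      toF (Δ h A X ⊕ h A) ² ∎
      where
      X = coords x
      A = coords a
      P = toF (h (X ⊕ A))
      Q = toF (h X)
      R = toF (h A)
      W = toF (X ⊙ A)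
      Δ⊕hA≈ : toF (Δ h A X ⊕ h A) ≈ ((P + Q) + W) + R
      Δ⊕hA≈ = ≈-trans (coord-⊕ ξ _ _) (+-congʳ (≈-trans (coord-⊕ ξ _ _) (+-congʳ (coord-⊕ ξ _ _))))

    square-of-translate : Vec Bool n → Bijection (≡.setoid (Vec Bool n)) setoid
    square-of-translate k = record
      { to = λ v → toF (v ⊕ k) ²
      ; cong = λ { refl → ≈-refl }
      ; bijective = (λ eq → ⊕-injectiveʳ k (toF-injective (²-injective eq))) , surjective
      }
      where
      surjective : ∀ y → ∃ λ u → ∀ {w} → w ≡ u → toF (w ⊕ k) ² ≈ y
      surjective y = let (v , v²≈y) = toF²-surjective y in
        v ⊕ k , λ { refl → ≈-trans (reflexive (cong (λ w → toF w ²) (⊕-cancelʳ v k))) v²≈y }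

    coordinates : Bijection setoid (≡.setoid (Vec Bool n))
    coordinates = record
      { to = coords
      ; cong = coords-cong
      ; bijective = coords-injective , λ v → toF v , λ z≈toFv → trans (coords-cong z≈toFv) (coords-toF v)
      }

    Δ-bijective⇔∇-permutation : ∀ a → Bijective _≡_ _≡_ (Δ h (coords a)) ⇔ IsPermutation F (∇ h a)
    Δ-bijective⇔∇-permutation a = sandwich-bijective⇔ (square-of-translate (h (coords a))) coordinates _ _ (∇-square a)

    all-Δ-bijective⇔all-∇-permutation : (∀ (A : Vec Bool n) → A ≢ replicate n false → Bijective _≡_ _≡_ (Δ h A))
                                ⇔ (∀ a → ¬ (a ≈ 0#) → IsPermutation F (∇ h a))
    all-Δ-bijective⇔all-∇-permutation = mk⇔
      (λ Δ-bijective a a≉0 →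
        Equivalence.to (Δ-bijective⇔∇-permutation a) (Δ-bijective (coords a) (λ A≡0 → a≉0 (coords≡0⇒≈0 A≡0))))
      (λ ∇-permutation A A≢0 → subst (λ A → Bijective _≡_ _≡_ (Δ h A)) (coords-toF A)
        (Equivalence.from (Δ-bijective⇔∇-permutation (toF A))
          (∇-permutation (toF A) (λ toFA≈0 → A≢0 (toF-injective (≈-trans toFA≈0 (≈-sym (coord-0 ξ))))))))

theorem2p1 : ∀ {c ℓ : Level} (n : ℕ) → 1 ≤ n →
    (D : Subset n) → IsTransversal D →
    (h : Vec Bool n → Vec Bool n) → IsF2Rep D h →
    (F : CommutativeRing c ℓ) → IsField F → Char2 F →
    (B : Basis F n) →
      (IsRDS n (2 ^ n) (2 ^ n) (2 ^ n) 1 in2Z4 D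
        ⇔ (∀ (a : Vec Bool n) → ¬ (a ≡ replicate n Bool.false) → Bijective _≡_ _≡_ (Δ h a)))
      × ((∀ (a : Vec Bool n) → ¬ (a ≡ replicate n Bool.false) → Bijective _≡_ _≡_ (Δ h a))
        ⇔ (∀ (a : CommutativeRing.Carrier F) → ¬ (CommutativeRing._≈_ F a (CommutativeRing.0# F))
             → IsPermutation F (Basis.∇ B h a)))
theorem2p1 n _ D transversal h h-represents F isField char2 B =
  RelativeDifferenceSet.rds⇔Δ-bijective D transversal h h-represents ,
  FieldWithBasis.all-Δ-bijective⇔all-∇-permutation F isField char2 B h
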